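{- If $n$ is a non-negative integer, then \[ \sum_{k = 1}^n \sum_{j = \lfloor n/2 \rfloor }^{k - 1} \frac{1}{n - j}\binom{j}{n - j} = F_{n + 1} - 1. \]
   Context: $F_n$ are the Fibonacci numbers ($F_0=0$, $F_1=1$, $F_n=F_{n-1}+F_{n-2}$). A sum whose upper limit is below its lower limit is $0$; $\binom{a}{b}=0$ when $b>a\ge0$. -}

module Defs where

open import Data.Nat using (ℕ; zero; suc; _+_; _∸_; _/_)
open import Data.Nat.Combinatorics using (_C_)
open import Data.Integer using (+_)
open import Data.Rational using (ℚ; 0ℚ; 1ℚ) renaming (_+_ to _+ℚ_; _/_ to _/ℚ_)

-- Σ_{j=a}^{b} f j  (inclusive; zero when b < a)
sumRange : ℕ → ℕ → (ℕ → ℚ) → ℚ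
sumRange a b f = go a (suc b ∸ a)
  where
  go : ℕ → ℕ → ℚ
  go i zero = 0ℚ
  go i (suc m) = f i +ℚ go (suc i) m

-- c / d as a rational; only ever applied with d ≥ 1 (d = 0 ↦ 0 is a junk value)
divQ : ℕ → ℕ → ℚ
divQ c zero = 0ℚ
divQ c (suc d) = (+ c) /ℚ suc d

fib : ℕ → ℕ
fib zero = zero
fib (suc zero) = suc zero
fib (suc (suc n)) = fib (suc n) + fib n

term : ℕ → ℕ → ℚ
term n j = divQ (j C (n ∸ j)) (n ∸ j)

lhs : ℕ → ℚ
lhs n = sumRange 1 n (λ k → sumRange (n / 2) (k ∸ 1) (term n))

-- Since binom(j, n - j) = 0 for j < ⌊n/2⌋, every inner sum may start at j = 0.
-- Exchanging the order of summation, the j-th term is counted n - j times, which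
-- cancels its factor 1/(n - j).  What remains is the shallow diagonal sum
-- Σ_{j ≤ n} binom(j, n - j) = F_{n+1} of Pascal's triangle, minus its last term
-- binom(n, 0) = 1.

module Submission where

open import Algebra.Bundles using (CommutativeMonoid)
open import Data.Nat as ℕ using (ℕ; zero; suc; _∸_; _≤_; _<_; _≤‴_; ≤‴-refl; ≤‴-step)
import Data.Nat.Properties as ℕ
open import Data.Nat.Combinatorics using (_C_; nCk+nC[k+1]≡[n+1]C[k+1]; k>n⇒nCk≡0)
open import Data.Nat.DivMod using (m/n*n≤m)
open import Data.Integer as ℤ using (+_)
import Data.Integer.Properties as ℤ
open import Data.Integer.Tactic.RingSolver using (solve-∀)
open import Data.Rational using (ℚ; 0ℚ; 1ℚ; _+_; _*_; _-_; _/_; toℚᵘ)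
import Data.Rational.Properties as ℚ
open import Data.Rational.Unnormalised as ℚᵘ using (mkℚᵘ; *≡*)
import Data.Rational.Unnormalised.Properties as ℚᵘ
open import Algebra.Properties.Group ℚ.+-0-group
  using (//-rightDividesʳ) renaming (∙-cancelˡ to +-cancelˡ)
open import Relation.Binary.PropositionalEquality
  using (_≡_; refl; sym; trans; cong; cong₂; module ≡-Reasoning)
open import Relation.Nullary using (yes; no)

open import Defs

module FiniteSum {c ℓ} (M : CommutativeMonoid c ℓ) where

  open CommutativeMonoid M renaming (refl to ≈-refl; sym to ≈-sym; trans to ≈-trans)
  open import Algebra.Properties.CommutativeSemigroup commutativeSemigroup
    using (interchange; x∙yz≈yx∙z)
  open import Algebra.Properties.Monoid.Mult monoid using (_×_; ×-congˡ; ×-homo-1) public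
  open import Relation.Binary.Reasoning.Setoid setoid

  ∑< : ℕ → (ℕ → Carrier) → Carrier
  ∑< zero    f = ε
  ∑< (suc m) f = ∑< m f ∙ f m

  infix 5 ∑<
  syntax ∑< m (λ j → e) = ∑[ j < m ] e

  ∑-cong : ∀ m {f g} → (∀ j → j < m → f j ≈ g j) → ∑< m f ≈ ∑< m g
  ∑-cong zero    f≈g = ≈-refl
  ∑-cong (suc m) f≈g =
    ∙-cong (∑-cong m (λ j j<m → f≈g j (ℕ.m<n⇒m<1+n j<m))) (f≈g m (ℕ.n<1+n m))

  ∑-zero : ∀ m {f} → (∀ j → j < m → f j ≈ ε) → ∑< m f ≈ ε
  ∑-zero m f≈ε = ≈-trans (∑-cong m f≈ε) (∑-ε m)
    where
    ∑-ε : ∀ m → ∑[ j < m ] ε ≈ ε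
    ∑-ε zero    = ≈-refl
    ∑-ε (suc m) = ≈-trans (identityʳ _) (∑-ε m)

  ∑-distrib-∙ : ∀ m (f g : ℕ → Carrier) → ∑[ j < m ] f j ∙ g j ≈ ∑< m f ∙ ∑< m g
  ∑-distrib-∙ zero    f g = ≈-sym (identityˡ ε)
  ∑-distrib-∙ (suc m) f g = ≈-trans (∙-congʳ (∑-distrib-∙ m f g)) (interchange _ _ _ _)

  ∑-head : ∀ m (f : ℕ → Carrier) → ∑[ j < suc m ] f j ≈ f 0 ∙ (∑[ j < m ] f (suc j))
  ∑-head zero    f = ≈-trans (identityˡ (f 0)) (≈-sym (identityʳ (f 0)))
  ∑-head (suc m) f = ≈-trans (∙-congʳ (∑-head m f)) (assoc _ _ _)

  ∑-triangle : ∀ N (f : ℕ → Carrier) →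
               ∑[ k < N ] ∑[ j < suc k ] f j ≈ ∑[ j < N ] (N ∸ j) × f j
  ∑-triangle zero    f = ≈-refl
  ∑-triangle (suc N) f = begin
    (∑[ k < N ] ∑[ j < suc k ] f j) ∙ (∑< N f ∙ f N)
      ≈⟨ ∙-congʳ (∑-triangle N f) ⟩
    (∑[ j < N ] (N ∸ j) × f j) ∙ (∑< N f ∙ f N)
      ≈⟨ x∙yz≈yx∙z _ _ _ ⟩
    (∑< N f ∙ (∑[ j < N ] (N ∸ j) × f j)) ∙ f N
      ≈⟨ ∙-congʳ (∑-distrib-∙ N f (λ j → (N ∸ j) × f j)) ⟨
    (∑[ j < N ] suc (N ∸ j) × f j) ∙ f N
      ≈⟨ ∙-cong (∑-cong N suc[N∸j]≈[1+N]∸j) f[N]≈[1+N∸N]×f[N] ⟩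
    ∑[ j < suc N ] (suc N ∸ j) × f j
      ∎
    where
    suc[N∸j]≈[1+N]∸j : ∀ j → j < N → suc (N ∸ j) × f j ≈ (suc N ∸ j) × f j
    suc[N∸j]≈[1+N]∸j j j<N = ×-congˡ (sym (ℕ.+-∸-assoc 1 (ℕ.<⇒≤ j<N)))
    f[N]≈[1+N∸N]×f[N] : f N ≈ (suc N ∸ N) × f N
    f[N]≈[1+N∸N]×f[N] = ≈-trans (≈-sym (×-homo-1 (f N))) (×-congˡ (sym (ℕ.m+n∸n≡m 1 N)))

open FiniteSum ℚ.+-0-commutativeMonoid
module ℕ∑ = FiniteSum ℕ.+-0-commutativeMonoid

fromℕ : ℕ → ℚ
fromℕ m = + m / 1

fromℕ-+ : ∀ m n → fromℕ (m ℕ.+ n) ≡ fromℕ m + fromℕ n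
fromℕ-+ m n = ℚ.toℚᵘ-injective (begin
  toℚᵘ (fromℕ (m ℕ.+ n))
    ≈⟨ ℚ.toℚᵘ-fromℚᵘ _ ⟩
  mkℚᵘ (+ (m ℕ.+ n)) 0
    ≈⟨ *≡* (trans (cong (ℤ._* + 1) (ℤ.pos-+ m n)) (cross-multiplied (+ m) (+ n))) ⟩
  mkℚᵘ (+ m) 0 ℚᵘ.+ mkℚᵘ (+ n) 0
    ≈⟨ ℚᵘ.+-cong (ℚ.toℚᵘ-fromℚᵘ (mkℚᵘ (+ m) 0)) (ℚ.toℚᵘ-fromℚᵘ (mkℚᵘ (+ n) 0)) ⟨
  toℚᵘ (fromℕ m) ℚᵘ.+ toℚᵘ (fromℕ n)
    ≈⟨ ℚ.toℚᵘ-homo-+ (fromℕ m) (fromℕ n) ⟨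
  toℚᵘ (fromℕ m + fromℕ n)
    ∎)
  where
  open ℚᵘ.≃-Reasoning
  cross-multiplied : ∀ x y → (x ℤ.+ y) ℤ.* + 1 ≡ (x ℤ.* + 1 ℤ.+ y ℤ.* + 1) ℤ.* + 1
  cross-multiplied = solve-∀

fromℕ-*-/ : ∀ c d → fromℕ (suc d) * (+ c / suc d) ≡ fromℕ c
fromℕ-*-/ c d = ℚ.toℚᵘ-injective (begin
  toℚᵘ (fromℕ (suc d) * (+ c / suc d))
    ≈⟨ ℚ.toℚᵘ-homo-* (fromℕ (suc d)) (+ c / suc d) ⟩
  toℚᵘ (fromℕ (suc d)) ℚᵘ.* toℚᵘ (+ c / suc d)
    ≈⟨ ℚᵘ.*-cong (ℚ.toℚᵘ-fromℚᵘ (mkℚᵘ (+ suc d) 0)) (ℚ.toℚᵘ-fromℚᵘ (mkℚᵘ (+ c) d)) ⟩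
  mkℚᵘ (+ suc d) 0 ℚᵘ.* mkℚᵘ (+ c) d
    ≈⟨ *≡* (cross-multiplied (+ suc d) (+ c)) ⟩
  mkℚᵘ (+ c) 0
    ≈⟨ ℚ.toℚᵘ-fromℚᵘ _ ⟨
  toℚᵘ (fromℕ c)
    ∎)
  where
  open ℚᵘ.≃-Reasoning
  cross-multiplied : ∀ x y → (x ℤ.* y) ℤ.* + 1 ≡ y ℤ.* (+ 1 ℤ.* x)
  cross-multiplied = solve-∀

×≡fromℕ-* : ∀ m x → m × x ≡ fromℕ m * x
×≡fromℕ-* zero    x = sym (ℚ.*-zeroˡ x)
×≡fromℕ-* (suc m) x = begin
  x + m × x                  ≡⟨ cong₂ _+_ (sym (ℚ.*-identityˡ x)) (×≡fromℕ-* m x) ⟩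
  1ℚ * x + fromℕ m * x       ≡⟨ ℚ.*-distribʳ-+ x 1ℚ (fromℕ m) ⟨
  (1ℚ + fromℕ m) * x         ≡⟨ cong (_* x) (fromℕ-+ 1 m) ⟨
  fromℕ (suc m) * x          ∎
  where open ≡-Reasoning

fromℕ-∑ : ∀ m g → fromℕ (ℕ∑.∑< m g) ≡ ∑[ j < m ] fromℕ (g j)
fromℕ-∑ zero    g = refl
fromℕ-∑ (suc m) g = trans (fromℕ-+ (ℕ∑.∑< m g) (g m)) (cong (_+ fromℕ (g m)) (fromℕ-∑ m g))

divQ-zero : ∀ d → divQ 0 d ≡ 0ℚ
divQ-zero zero    = refl
divQ-zero (suc d) = ℚ.0/n≡0 (suc d)

×-divQ : ∀ c {d} → 0 < d → d × divQ c d ≡ fromℕ c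
×-divQ c {suc d} _ = trans (×≡fromℕ-* (suc d) _) (fromℕ-*-/ c d)

sumRange-empty : ∀ {a b} f → b < a → sumRange a b f ≡ 0ℚ
sumRange-empty f b<a rewrite ℕ.m≤n⇒m∸n≡0 b<a = refl

sumRange-step : ∀ {a b} f → a ≤ b → sumRange a b f ≡ f a + sumRange (suc a) b f
sumRange-step f a≤b rewrite ℕ.+-∸-assoc 1 a≤b = refl

∑-+-sumRange : ∀ {a b} f → a ≤‴ suc b → ∑< a f + sumRange a b f ≡ ∑< (suc b) f
∑-+-sumRange {b = b} f ≤‴-refl =
  trans (cong (_+_ (∑< (suc b) f)) (sumRange-empty f (ℕ.n<1+n b))) (ℚ.+-identityʳ _)
∑-+-sumRange {a} {b} f (≤‴-step a<‴1+b) = begin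
  ∑< a f + sumRange a b f                ≡⟨ cong (_+_ (∑< a f)) (sumRange-step f a≤b) ⟩
  ∑< a f + (f a + sumRange (suc a) b f)  ≡⟨ ℚ.+-assoc (∑< a f) (f a) _ ⟨
  ∑< (suc a) f + sumRange (suc a) b f    ≡⟨ ∑-+-sumRange f a<‴1+b ⟩
  ∑< (suc b) f                           ∎
  where
  open ≡-Reasoning
  a≤b : a ≤ b
  a≤b = ℕ.≤-pred (ℕ.≤‴⇒≤ a<‴1+b)

sumRange-from-1 : ∀ b f → sumRange 1 b f ≡ ∑[ k < b ] f (suc k)
sumRange-from-1 b f = +-cancelˡ (f 0) _ _ (begin
  f 0 + sumRange 1 b f             ≡⟨ cong (_+ sumRange 1 b f) (ℚ.+-identityˡ (f 0)) ⟨
  ∑< 1 f + sumRange 1 b f          ≡⟨ ∑-+-sumRange {b = b} f (ℕ.≤⇒≤‴ (ℕ.s≤s ℕ.z≤n)) ⟩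
  ∑< (suc b) f                     ≡⟨ ∑-head b f ⟩
  f 0 + (∑[ k < b ] f (suc k))     ∎)
  where open ≡-Reasoning

vanishesBelow⇒sumRange≡∑ : ∀ {a} b f → (∀ j → j < a → f j ≡ 0ℚ) →
                           sumRange a b f ≡ ∑< (suc b) f
vanishesBelow⇒sumRange≡∑ {a} b f f≡0 with a ℕ.≤? suc b
... | yes a≤1+b = begin
  sumRange a b f               ≡⟨ ℚ.+-identityˡ _ ⟨
  0ℚ + sumRange a b f          ≡⟨ cong (_+ sumRange a b f) (∑-zero a f≡0) ⟨
  ∑< a f + sumRange a b f      ≡⟨ ∑-+-sumRange f (ℕ.≤⇒≤‴ a≤1+b) ⟩
  ∑< (suc b) f                 ∎
  where open ≡-Reasoning
... | no a≰1+b = trans (sumRange-empty f (ℕ.<⇒≤ 1+b<a))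
                       (sym (∑-zero (suc b) (λ j j<1+b → f≡0 j (ℕ.<-trans j<1+b 1+b<a))))
  where
  1+b<a : suc b < a
  1+b<a = ℕ.≰⇒> a≰1+b

m<n/2⇒m<n∸m : ∀ {m} n → m < n ℕ./ 2 → m < n ∸ m
m<n/2⇒m<n∸m {m} n m<n/2 = ℕ.m+n≤o⇒m≤o∸n (suc m) (begin
  suc m ℕ.+ m           ≤⟨ ℕ.+-monoʳ-≤ (suc m) (ℕ.n≤1+n m) ⟩
  suc m ℕ.+ suc m       ≡⟨ cong (suc m ℕ.+_) (ℕ.+-identityʳ (suc m)) ⟨
  2 ℕ.* suc m           ≡⟨ ℕ.*-comm 2 (suc m) ⟩
  suc m ℕ.* 2           ≤⟨ ℕ.*-monoˡ-≤ 2 m<n/2 ⟩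
  (n ℕ./ 2) ℕ.* 2       ≤⟨ m/n*n≤m n 2 ⟩
  n                     ∎)
  where open ℕ.≤-Reasoning

term-vanishes : ∀ n {j} → j < n ℕ./ 2 → term n j ≡ 0ℚ
term-vanishes n {j} j<n/2 rewrite k>n⇒nCk≡0 (m<n/2⇒m<n∸m n j<n/2) = divQ-zero (n ∸ j)

×-term : ∀ n {j} → j < n → (n ∸ j) × term n j ≡ fromℕ (j C (n ∸ j))
×-term n j<n = ×-divQ _ (ℕ.m<n⇒0<n∸m j<n)

shallowDiagonal : ℕ → ℕ
shallowDiagonal n = ℕ∑.∑< (suc n) (λ j → j C (n ∸ j))

shallowDiagonal-split : ∀ n → shallowDiagonal n ≡ ℕ∑.∑< n (λ j → j C (n ∸ j)) ℕ.+ 1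
shallowDiagonal-split n = cong (λ k → ℕ∑.∑< n (λ j → j C (n ∸ j)) ℕ.+ n C k) (ℕ.n∸n≡0 n)

shallowDiagonal-rec : ∀ n →
  shallowDiagonal (suc (suc n)) ≡ shallowDiagonal (suc n) ℕ.+ shallowDiagonal n
shallowDiagonal-rec n = begin
  shallowDiagonal (suc (suc n))
    ≡⟨ ℕ∑.∑-head (suc (suc n)) _ ⟩
  ℕ∑.∑< (suc n) (λ j → suc j C (suc n ∸ j)) ℕ.+ suc (suc n) C (suc n ∸ suc n)
    ≡⟨ cong₂ ℕ._+_ (ℕ∑.∑-cong (suc n) pascal) (cong (suc (suc n) C_) (ℕ.n∸n≡0 n)) ⟩
  ℕ∑.∑< (suc n) (λ j → j C (n ∸ j) ℕ.+ j C (suc n ∸ j)) ℕ.+ 1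
    ≡⟨ cong (ℕ._+ 1) (ℕ∑.∑-distrib-∙ (suc n) _ _) ⟩
  (shallowDiagonal n ℕ.+ ℕ∑.∑< (suc n) (λ j → j C (suc n ∸ j))) ℕ.+ 1
    ≡⟨ ℕ.+-assoc (shallowDiagonal n) _ 1 ⟩
  shallowDiagonal n ℕ.+ (ℕ∑.∑< (suc n) (λ j → j C (suc n ∸ j)) ℕ.+ 1)
    ≡⟨ cong (shallowDiagonal n ℕ.+_) (shallowDiagonal-split (suc n)) ⟨
  shallowDiagonal n ℕ.+ shallowDiagonal (suc n)
    ≡⟨ ℕ.+-comm (shallowDiagonal n) _ ⟩
  shallowDiagonal (suc n) ℕ.+ shallowDiagonal n
    ∎
  where
  open ≡-Reasoning
  pascal : ∀ j → j < suc n → suc j C (suc n ∸ j) ≡ j C (n ∸ j) ℕ.+ j C (suc n ∸ j)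
  pascal j j<1+n rewrite ℕ.+-∸-assoc 1 (ℕ.≤-pred j<1+n) =
    sym (nCk+nC[k+1]≡[n+1]C[k+1] j (n ∸ j))

shallowDiagonal≡fib : ∀ n → shallowDiagonal n ≡ fib (suc n)
shallowDiagonal≡fib zero          = refl
shallowDiagonal≡fib (suc zero)    = refl
shallowDiagonal≡fib (suc (suc n)) =
  trans (shallowDiagonal-rec n) (cong₂ ℕ._+_ (shallowDiagonal≡fib (suc n)) (shallowDiagonal≡fib n))

fromℕ[m+1]-1≡fromℕ[m] : ∀ m → fromℕ (m ℕ.+ 1) - 1ℚ ≡ fromℕ m
fromℕ[m+1]-1≡fromℕ[m] m = trans (cong (_- 1ℚ) (fromℕ-+ m 1)) (//-rightDividesʳ 1ℚ (fromℕ m))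

proposition13 : (n : ℕ) → lhs n ≡ ((+ fib (suc n)) / 1) - 1ℚ
proposition13 n = begin
  lhs n                                     ≡⟨ sumRange-from-1 n _ ⟩
  ∑[ k < n ] sumRange (n ℕ./ 2) k (term n)  ≡⟨ ∑-cong n (λ k _ → inner-from-0 k) ⟩
  ∑[ k < n ] ∑[ j < suc k ] term n j        ≡⟨ ∑-triangle n (term n) ⟩
  ∑[ j < n ] (n ∸ j) × term n j             ≡⟨ ∑-cong n (λ j → ×-term n) ⟩
  ∑[ j < n ] fromℕ (j C (n ∸ j))            ≡⟨ fromℕ-∑ n _ ⟨
  fromℕ S                                   ≡⟨ fromℕ[m+1]-1≡fromℕ[m] S ⟨
  fromℕ (S ℕ.+ 1) - 1ℚ                      ≡⟨ cong (λ m → fromℕ m - 1ℚ) S+1≡fib ⟩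
  fromℕ (fib (suc n)) - 1ℚ                  ∎
  where
  open ≡-Reasoning
  inner-from-0 : ∀ k → sumRange (n ℕ./ 2) k (term n) ≡ ∑[ j < suc k ] term n j
  inner-from-0 k = vanishesBelow⇒sumRange≡∑ k (term n) (λ j → term-vanishes n)
  S : ℕ
  S = ℕ∑.∑< n (λ j → j C (n ∸ j))
  S+1≡fib : S ℕ.+ 1 ≡ fib (suc n)
  S+1≡fib = trans (sym (shallowDiagonal-split n)) (shallowDiagonal≡fib n)
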